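{- Let $G$ be a graph, $\mathcal{T}$ a tree decomposition of $G$, and $W$ a nonempty set of vertices of $G$. Then $W$ is covered by a set of at most $2\alpha(W)-1$ bags of $\mathcal{T}$.
   Context: A tree decomposition $\mathcal{T}=(T,\{X_t\}_{t\in V(T)})$ of $G$ consists of a tree $T$ and bags $X_t\subseteq V(G)$ such that every vertex is in some bag, every edge has both endpoints in some bag, and for each vertex the nodes whose bags contain it induce a connected subtree of $T$. $\alpha(W)$ is the maximum size of an independent set in $G[W]$. $W$ is covered by a set $\mathcal{B}$ of bags if every vertex of $W$ lies in at least one bag of $\mathcal{B}$. -}

module Defs where

open import Data.Nat using (ℕ; suc; _≤_)
open import Data.Fin using (Fin)
open import Data.Fin.Subset using (Subset; _∈_; _⊆_; ∣_∣)
open import Data.List using (List; []; _∷_; _++_; [_]; length)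
open import Data.List.Relation.Unary.Linked using (Linked)
open import Data.List.Relation.Unary.Unique.Propositional using (Unique)
open import Data.Product using (Σ; ∃; _×_)
open import Data.Unit using (⊤)
open import Relation.Nullary using (¬_)
open import Relation.Binary using (Decidable)
open import Relation.Binary.PropositionalEquality using (_≡_)

record Graph (n : ℕ) : Set₁ where
  field
    Adj    : Fin n → Fin n → Set
    adj?   : Decidable Adj
    sym    : ∀ {u v} → Adj u v → Adj v u
    irrefl : ∀ {u} → ¬ Adj u u

open Graph public

data WalkIn {n : ℕ} (G : Graph n) (P : Fin n → Set) : Fin n → Fin n → Set where
  here : ∀ {u} → P u → WalkIn G P u u
  step : ∀ {u v w} → P u → Adj G u v → WalkIn G P v w → WalkIn G P u w

Connected : {n : ℕ} → Graph n → Set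
Connected G = ∀ u v → WalkIn G (λ _ → ⊤) u v

-- A cycle x ∷ xs: at least 3 distinct vertices, consecutive ones adjacent,
-- and the last one adjacent to x.
record Cycle {n : ℕ} (G : Graph n) : Set where
  field
    x        : Fin n
    xs       : List (Fin n)
    long     : 2 ≤ length xs
    distinct : Unique (x ∷ xs)
    closed   : Linked (Adj G) (x ∷ xs ++ [ x ])

Acyclic : {n : ℕ} → Graph n → Set
Acyclic G = ¬ Cycle G

record IsTree {m : ℕ} (T : Graph m) : Set where
  field
    nonempty  : Fin m
    connected : Connected T
    acyclic   : Acyclic T

record TreeDecomposition {n : ℕ} (G : Graph n) (m : ℕ) : Set₁ where
  field
    T          : Graph m
    isTree     : IsTree T
    bag        : Fin m → Subset n
    vertexCov  : ∀ v → ∃ λ t → v ∈ bag t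
    edgeCov    : ∀ u v → Adj G u v → ∃ λ t → (u ∈ bag t × v ∈ bag t)
    subtree    : ∀ v t t′ → v ∈ bag t → v ∈ bag t′ → WalkIn T (λ s → v ∈ bag s) t t′

open TreeDecomposition public

IndependentIn : {n : ℕ} → Graph n → Subset n → Subset n → Set
IndependentIn G W I = I ⊆ W × (∀ {u v} → u ∈ I → v ∈ I → ¬ Adj G u v)

IndependenceNumber : {n : ℕ} → Graph n → Subset n → ℕ → Set
IndependenceNumber G W k =
  (∃ λ I → IndependentIn G W I × ∣ I ∣ ≡ k) ×
  (∀ I → IndependentIn G W I → ∣ I ∣ ≤ k)

CoveredBy : {n m : ℕ} {G : Graph n} → TreeDecomposition G m → Subset n → Subset m → Set
CoveredBy 𝒯 W B = ∀ {v} → v ∈ W → ∃ λ t → t ∈ B × v ∈ bag 𝒯 t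

-- Root the tree and let top w be the node nearest the root whose bag contains w.
-- Take w ∈ W whose top lies deepest. A neighbour v ∈ W of w shares a bag x with w;
-- both top w and top v are ancestors of x, and top v is not below top w, so the
-- subtree of bags containing v climbs from x through top w: v lies in the bag of top w.
-- Hence that single bag covers w and all its neighbours in W, and recursing on the
-- rest of W matches the chosen bags with an independent set. So α(W) bags suffice,
-- and α(W) ≤ 2α(W) − 1 as α(W) ≥ 1.
module Submission where

open import Defs
open import Data.Nat using (ℕ; zero; suc; _≤_; _<_; _*_; _∸_; _+_; z≤n; s≤s)
open import Data.Nat.Properties
  using (≤-refl; ≤-trans; ≤-total; ≤-antisym; ≤-pred; ≤-reflexive; <-irrefl; <⇒≤; ≮⇒≥; n≤1+n;
         m≤m+n; m≤n+m; m<1+n⇒m<n∨m≡n; n∸n≡0; m∸n≤m; ∸-+-assoc; ∸-cancelˡ-≡; m∸n≢0⇒n<m;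
         suc-injective; <-cmp; <-trans; <⇒≢; 1+n≰n; m<n⇒m<1+n; m<n⇒0<n∸m; ≤⇒≯)
import Data.Nat as ℕ
open import Data.Fin using (Fin; zero; suc; _≟_)
open import Data.Fin.Properties using (any?)
open import Data.Fin.Subset using (Subset; Nonempty; ∣_∣; ⊥; ⁅_⁆; _∪_; _∩_; ∁; _⊆_; _⊂_; _∈_; _∉_)
open import Data.Fin.Subset.Properties
  using (_∈?_; nonempty?; ∉⊥; ∣⊥∣≡0; ∣⁅x⁆∣≡1; x∈⁅x⁆; x∈⁅y⁆⇒x≡y; x∈p∪q⁺; x∈p∪q⁻; x∈p∩q⁺; x∈p∩q⁻;
         x∈∁p⇒x∉p; x∉p⇒x∈∁p; p⊆p∪q; p∩q⊆p; p⊂q⇒∣p∣<∣q∣; ∪-identityʳ)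
open import Data.Fin.Subset.Induction using (⊂-wellFounded)
open import Data.Bool using (true; false)
open import Data.Vec using (_∷_)
open import Data.List using (List; []; _∷_; _++_; [_]; applyUpTo; applyDownFrom)
open import Data.List.Properties using (++-assoc; length-++-≤ʳ)
open import Data.List.Relation.Unary.All using (All; []; _∷_) renaming (lookup to All-lookup)
open import Data.List.Relation.Unary.Linked using (Linked; [-]; _∷_)
open import Data.List.Relation.Unary.Unique.Propositional using (Unique)
open import Data.List.Relation.Unary.AllPairs using ([]; _∷_)
import Data.List.Relation.Unary.Unique.Propositional.Properties as Unique
open import Data.List.Membership.Propositional using () renaming (_∈_ to _∈ᴸ_)
open import Data.List.Membership.Propositional.Properties using (∈-applyUpTo⁻; ∈-applyDownFrom⁻; ∈-++⁻)
open import Data.Product using (∃; ∃₂; _×_; _,_; proj₁; proj₂)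
open import Data.Sum using (_⊎_; inj₁; inj₂; [_,_]′)
open import Data.Empty using (⊥-elim)
open import Function using (_∘_)
open import Induction.WellFounded using (module All)
open import Relation.Nullary using (¬_; yes; no; _×-dec_)
open import Relation.Unary using (Pred) renaming (Decidable to Decidable₁)
open import Relation.Binary using (Rel; Transitive; Total; tri<; tri≈; tri>)
open import Relation.Binary.PropositionalEquality using (_≡_; _≢_; refl; trans; cong; subst)
import Relation.Binary.PropositionalEquality as ≡

MinimalWitness : ∀ {p} → Pred ℕ p → Set p
MinimalWitness P = ∃ λ n → P n × (∀ {k} → P k → n ≤ k)

minimal-witness : ∀ {p} {P : Pred ℕ p} → Decidable₁ P → ∃ P → MinimalWitness P
minimal-witness {P = P} P? (n , pn) with first-below (suc n)
  where
    first-below : ∀ N → (∀ {k} → k < N → ¬ P k) ⊎ MinimalWitness P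
    first-below zero = inj₁ λ ()
    first-below (suc N) with first-below N
    ... | inj₂ least = inj₂ least
    ... | inj₁ none with P? N
    ...   | yes pN = inj₂ (N , pN , λ pk → ≮⇒≥ (λ k<N → none k<N pk))
    ...   | no ¬pN = inj₁ λ k<1+N pk →
              [ (λ k<N → none k<N pk) , (λ { refl → ¬pN pk }) ]′ (m<1+n⇒m<n∨m≡n k<1+N)
... | inj₁ none  = ⊥-elim (none ≤-refl pn)
... | inj₂ least = least

module _ {a r} {A : Set a} {_≼_ : Rel A r} (≼-trans : Transitive _≼_) (≼-total : Total _≼_) where

  private
    ≼-refl : ∀ {x} → x ≼ x
    ≼-refl {x} = [ (λ r → r) , (λ r → r) ]′ (≼-total x x)

  optimum : ∀ {n q} {Q : Pred (Fin n) q} → Decidable₁ Q → (f : Fin n → A) → ∃ Q →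
            ∃ λ t → Q t × (∀ {u} → Q u → f t ≼ f u)
  optimum {suc n} {Q = Q} Q? f (t₀ , q₀) with any? (Q? ∘ suc)
  ... | no none = zero , at-zero t₀ q₀ , λ { {zero} _ → ≼-refl ; {suc u} qu → ⊥-elim (none (u , qu)) }
    where
      at-zero : ∀ t → Q t → Q zero
      at-zero zero    q = q
      at-zero (suc t) q = ⊥-elim (none (t , q))
  ... | yes some with optimum (Q? ∘ suc) (f ∘ suc) some | Q? zero
  ...   | t , qt , opt | no ¬q₀ = suc t , qt , λ { {zero} q → ⊥-elim (¬q₀ q) ; {suc u} qu → opt qu }
  ...   | t , qt , opt | yes q₀ with ≼-total (f zero) (f (suc t))
  ...     | inj₁ 0≼t = zero  , q₀ , λ { {zero} _ → ≼-refl ; {suc u} qu → ≼-trans 0≼t (opt qu) }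
  ...     | inj₂ t≼0 = suc t , qt , λ { {zero} _ → t≼0    ; {suc u} qu → opt qu }

module _ {a r} {A : Set a} {R : Rel A r} where

  applyUpTo-linked : ∀ (f : ℕ → A) n {rest} → (∀ {i} → i < n → R (f i) (f (suc i))) →
                     Linked R (f n ∷ rest) → Linked R (applyUpTo f (suc n) ++ rest)
  applyUpTo-linked f zero    _    chain = chain
  applyUpTo-linked f (suc n) link chain = link (s≤s z≤n) ∷ applyUpTo-linked (f ∘ suc) n (link ∘ s≤s) chain

  applyDownFrom-linked : ∀ (f : ℕ → A) n {rest} → (∀ {i} → i < n → R (f (suc i)) (f i)) →
                         Linked R (f 0 ∷ rest) → Linked R (applyDownFrom f (suc n) ++ rest)
  applyDownFrom-linked f zero    _    chain = chain
  applyDownFrom-linked f (suc n) link chain = link ≤-refl ∷ applyDownFrom-linked f n (link ∘ m<n⇒m<1+n) chain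

module Rooted {m : ℕ} (T : Graph m) (tree : IsTree T) where
  open IsTree tree

  root : Fin m
  root = nonempty

  ReachesRootIn : ℕ → Pred (Fin m) _
  ReachesRootIn zero    t = t ≡ root
  ReachesRootIn (suc L) t = t ≡ root ⊎ ∃ λ s → Adj T t s × ReachesRootIn L s

  reachesRootIn? : ∀ L → Decidable₁ (ReachesRootIn L)
  reachesRootIn? zero    t = t ≟ root
  reachesRootIn? (suc L) t with t ≟ root | any? (λ s → adj? T t s ×-dec reachesRootIn? L s)
  ... | yes t≡r | _       = yes (inj₁ t≡r)
  ... | no _    | yes nbr = yes (inj₂ nbr)
  ... | no t≢r  | no ¬nbr = no [ t≢r , ¬nbr ]′

  walk⇒reachesRoot : ∀ {P t} → WalkIn T P t root → ∃ λ L → ReachesRootIn L t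
  walk⇒reachesRoot (here _)      = zero , refl
  walk⇒reachesRoot (step _ ts w) with walk⇒reachesRoot w
  ... | L , reach = suc L , inj₂ (_ , ts , reach)

  depth-witness : ∀ t → MinimalWitness (λ L → ReachesRootIn L t)
  depth-witness t = minimal-witness (λ L → reachesRootIn? L t) (walk⇒reachesRoot (connected t root))

  depth : Fin m → ℕ
  depth t = proj₁ (depth-witness t)

  reachesRootIn-depth : ∀ t → ReachesRootIn (depth t) t
  reachesRootIn-depth t = proj₁ (proj₂ (depth-witness t))

  depth-minimal : ∀ {L t} → ReachesRootIn L t → depth t ≤ L
  depth-minimal {t = t} = proj₂ (proj₂ (depth-witness t))

  depth-root : depth root ≡ 0
  depth-root = ≤-antisym (depth-minimal refl) z≤n

  depth≡0⇒root : ∀ {t} → depth t ≡ 0 → t ≡ root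
  depth≡0⇒root {t} d≡0 = subst (λ L → ReachesRootIn L t) d≡0 (reachesRootIn-depth t)

  depth-adj : ∀ {t s} → Adj T t s → depth t ≤ suc (depth s)
  depth-adj {s = s} ts = depth-minimal (inj₂ (s , ts , reachesRootIn-depth s))

  toward-root : ∀ {t} → t ≢ root → ∃ λ s → Adj T t s × depth t ≡ suc (depth s)
  toward-root {t} t≢r = go (depth t) (reachesRootIn-depth t) refl
    where
      go : ∀ L → ReachesRootIn L t → depth t ≡ L → ∃ λ s → Adj T t s × depth t ≡ suc (depth s)
      go zero    t≡r                _      = ⊥-elim (t≢r t≡r)
      go (suc L) (inj₁ t≡r)         _      = ⊥-elim (t≢r t≡r)
      go (suc L) (inj₂ (s , ts , reach)) d≡1+L =
        s , ts , trans d≡1+L (cong suc (≤-antisym (≤-pred (subst (_≤ suc (depth s)) d≡1+L (depth-adj ts)))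
                                                  (depth-minimal reach)))

  parent : Fin m → Fin m
  parent t with t ≟ root
  ... | yes _   = root
  ... | no t≢r = proj₁ (toward-root t≢r)

  parent-root : parent root ≡ root
  parent-root with root ≟ root
  ... | yes _   = refl
  ... | no r≢r = ⊥-elim (r≢r refl)

  parent-child : ∀ {t} → t ≢ root → Adj T t (parent t) × depth t ≡ suc (depth (parent t))
  parent-child {t} t≢r with t ≟ root
  ... | yes t≡r = ⊥-elim (t≢r t≡r)
  ... | no t≢r′ = proj₂ (toward-root t≢r′)

  depth-parent : ∀ t → depth (parent t) ≡ depth t ∸ 1
  depth-parent t with t ≟ root
  ... | yes refl = trans depth-root (cong (_∸ 1) (≡.sym depth-root))
  ... | no t≢r  = cong (_∸ 1) (≡.sym (proj₂ (proj₂ (toward-root t≢r))))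

  depth>0⇒≢root : ∀ {t} → 0 < depth t → t ≢ root
  depth>0⇒≢root 0<d refl = <-irrefl (≡.sym depth-root) 0<d

  adj-parent⇒≢root : ∀ {t} → Adj T t (parent t) → t ≢ root
  adj-parent⇒≢root tp refl = irrefl T (subst (Adj T root) parent-root tp)

  ancestor : ℕ → Fin m → Fin m
  ancestor zero    t = t
  ancestor (suc i) t = ancestor i (parent t)

  ancestor-suc : ∀ i t → ancestor (suc i) t ≡ parent (ancestor i t)
  ancestor-suc zero    t = refl
  ancestor-suc (suc i) t = ancestor-suc i (parent t)

  depth-ancestor : ∀ i t → depth (ancestor i t) ≡ depth t ∸ i
  depth-ancestor zero    t = refl
  depth-ancestor (suc i) t = trans (depth-ancestor i (parent t))
                                   (trans (cong (_∸ i) (depth-parent t)) (∸-+-assoc (depth t) 1 i))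

  ancestor-depth : ∀ t → ancestor (depth t) t ≡ root
  ancestor-depth t = depth≡0⇒root (trans (depth-ancestor (depth t) t) (n∸n≡0 (depth t)))

  depth-ancestor-injective : ∀ {i j} t → i ≤ depth t → j ≤ depth t →
                             depth (ancestor i t) ≡ depth (ancestor j t) → i ≡ j
  depth-ancestor-injective {i} {j} t i≤d j≤d eq =
    ∸-cancelˡ-≡ i≤d j≤d (trans (≡.sym (depth-ancestor i t)) (trans eq (depth-ancestor j t)))

  adj-ancestor : ∀ {i} t → i < depth t → Adj T (ancestor i t) (ancestor (suc i) t)
  adj-ancestor {i} t i<d = subst (Adj T (ancestor i t)) (≡.sym (ancestor-suc i t))
    (proj₁ (parent-child (depth>0⇒≢root (subst (0 <_) (≡.sym (depth-ancestor i t)) (m<n⇒0<n∸m i<d)))))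

  depth-ancestor-≤ : ∀ i t → depth (ancestor i t) ≤ depth t
  depth-ancestor-≤ i t = subst (_≤ depth t) (≡.sym (depth-ancestor i t)) (m∸n≤m (depth t) i)

  module _ {x y} (x≢y : x ≢ y) (same-depth : depth x ≡ depth y) where

    private
      same-depth-ancestors : ∀ {i k} → i ≤ depth x → k ≤ depth x → ancestor i x ≡ ancestor k y → i ≡ k
      same-depth-ancestors {i} {k} i≤d k≤d eq = ∸-cancelˡ-≡ i≤d k≤d (begin
        depth x ∸ i          ≡⟨ ≡.sym (depth-ancestor i x) ⟩
        depth (ancestor i x) ≡⟨ cong depth eq ⟩
        depth (ancestor k y) ≡⟨ depth-ancestor k y ⟩
        depth y ∸ k          ≡⟨ cong (_∸ k) (≡.sym same-depth) ⟩
        depth x ∸ k          ∎)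
        where open ≡.≡-Reasoning

      meet-at-root : ancestor (depth x) x ≡ ancestor (depth x) y
      meet-at-root = trans (ancestor-depth x)
                           (≡.sym (subst (λ d → ancestor d y ≡ root) (≡.sym same-depth) (ancestor-depth y)))

    first-common-ancestor : ∃ λ j → ancestor (suc j) x ≡ ancestor (suc j) y × suc j ≤ depth x ×
                                    (∀ {k} → k ≤ j → ancestor k x ≢ ancestor k y)
    first-common-ancestor with minimal-witness (λ j → ancestor j x ≟ ancestor j y) (depth x , meet-at-root)
    ... | zero  , x≡y  , _     = ⊥-elim (x≢y x≡y)
    ... | suc j , meet , first = j , meet , first meet-at-root , λ k≤j eq → ≤⇒≯ k≤j (first eq)

    equal-depth-cycle : (conn : List (Fin m)) → Unique conn → All (λ c → depth x < depth c) conn →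
                        Linked (Adj T) (y ∷ conn ++ [ x ]) → Cycle T
    equal-depth-cycle conn conn-unique conn-deep closing with first-common-ancestor
    ... | j , meet , J≤dx , apart = record
      { x        = x
      ; xs       = applyUpTo (λ i → ancestor (suc i) x) J ++ (down ++ conn)
      ; long     = s≤s (≤-trans (s≤s z≤n)
                       (length-++-≤ʳ (down ++ conn) {applyUpTo (λ i → ancestor (2 + i) x) j}))
      ; distinct = Unique.++⁺ up-unique (Unique.++⁺ down-unique conn-unique down∩conn) up∩rest
      ; closed   = subst (Linked (Adj T)) (≡.sym reassoc)
                     (applyUpTo-linked (λ i → ancestor i x) J (λ i<J → adj-ancestor x (≤J⇒≤dx i<J))
                       (subst (λ z → Linked (Adj T) (z ∷ down ++ conn ++ [ x ])) (≡.sym meet)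
                         (applyDownFrom-linked (λ i → ancestor i y) J
                           (λ i<J → sym T (adj-ancestor y (≤J⇒≤dy i<J))) closing)))
      }
      where
        J = suc j
        -- The cycle runs from x up to the first common ancestor of x and y, down to y, and back along conn.
        up   = applyUpTo (λ i → ancestor i x) (suc J)
        down = applyDownFrom (λ i → ancestor i y) J

        ≤J⇒≤dx : ∀ {i} → i ≤ J → i ≤ depth x
        ≤J⇒≤dx i≤J = ≤-trans i≤J J≤dx
        ≤J⇒≤dy : ∀ {i} → i ≤ J → i ≤ depth y
        ≤J⇒≤dy i≤J = subst (_ ≤_) same-depth (≤J⇒≤dx i≤J)

        reassoc : (up ++ (down ++ conn)) ++ [ x ] ≡ up ++ (down ++ (conn ++ [ x ]))
        reassoc = trans (++-assoc up (down ++ conn) [ x ]) (cong (up ++_) (++-assoc down conn [ x ]))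

        outside-conn : ∀ {v} → depth v ≤ depth x → ¬ v ∈ᴸ conn
        outside-conn v≤x v∈ = ≤⇒≯ v≤x (All-lookup conn-deep v∈)

        up-unique : Unique up
        up-unique = Unique.applyUpTo⁺₁ _ (suc J) λ i<k k<1+J eq →
          <⇒≢ i<k (depth-ancestor-injective x (≤J⇒≤dx (≤-pred (≤-trans (s≤s (<⇒≤ i<k)) k<1+J)))
                                               (≤J⇒≤dx (≤-pred k<1+J)) (cong depth eq))

        down-unique : Unique down
        down-unique = Unique.applyDownFrom⁺₁ _ J λ k<i i<J eq →
          <⇒≢ k<i (≡.sym (depth-ancestor-injective y (≤J⇒≤dy (<⇒≤ i<J)) (≤J⇒≤dy (<⇒≤ (<-trans k<i i<J)))
                                                     (cong depth eq)))

        down∩conn : ∀ {v} → ¬ (v ∈ᴸ down × v ∈ᴸ conn)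
        down∩conn (v∈down , v∈conn) with ∈-applyDownFrom⁻ (λ i → ancestor i y) v∈down
        ... | i , _ , refl =
          outside-conn (subst (depth (ancestor i y) ≤_) (≡.sym same-depth) (depth-ancestor-≤ i y)) v∈conn

        up∩rest : ∀ {v} → ¬ (v ∈ᴸ up × v ∈ᴸ down ++ conn)
        up∩rest (v∈up , v∈rest) with ∈-applyUpTo⁻ (λ i → ancestor i x) v∈up | ∈-++⁻ down v∈rest
        ... | i , _ , refl | inj₂ v∈conn = outside-conn (depth-ancestor-≤ i x) v∈conn
        ... | i , i<1+J , refl | inj₁ v∈down with ∈-applyDownFrom⁻ (λ i → ancestor i y) v∈down
        ...   | k , k<J , eq with same-depth-ancestors (≤J⇒≤dx (≤-pred i<1+J)) (≤J⇒≤dx (<⇒≤ k<J)) eq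
        ...     | refl = apart (≤-pred k<J) eq

  deeper-neighbour⇒parent : ∀ {a b} → Adj T a b → depth a < depth b → a ≡ parent b
  deeper-neighbour⇒parent {a} {b} ab a<b with a ≟ parent b
  ... | yes a≡pb = a≡pb
  ... | no a≢pb  = ⊥-elim (acyclic (equal-depth-cycle a≢pb a≈pb [ b ] ([] ∷ []) (a<b ∷ [])
                                       (sym T (proj₁ b-pb) ∷ sym T ab ∷ [-])))
    where
      b-pb = parent-child (depth>0⇒≢root (≤-trans (s≤s z≤n) a<b))
      a≈pb : depth a ≡ depth (parent b)
      a≈pb = suc-injective (trans (≤-antisym a<b (depth-adj (sym T ab))) (proj₂ b-pb))

  adj⇒parent : ∀ {a b} → Adj T a b → b ≡ parent a ⊎ a ≡ parent b
  adj⇒parent {a} {b} ab with <-cmp (depth a) (depth b)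
  ... | tri< a<b _ _ = inj₂ (deeper-neighbour⇒parent ab a<b)
  ... | tri> _ _ b<a = inj₁ (deeper-neighbour⇒parent (sym T ab) b<a)
  ... | tri≈ _ a≈b _ = ⊥-elim (acyclic (equal-depth-cycle a≢b a≈b [] [] [] (sym T ab ∷ [-])))
    where
      a≢b : a ≢ b
      a≢b refl = irrefl T ab

  child-depth : ∀ {a} → Adj T a (parent a) → depth a ≡ suc (depth (parent a))
  child-depth ap = proj₂ (parent-child (adj-parent⇒≢root ap))

  Ancestor : Fin m → Fin m → Set
  Ancestor z a = ∃ λ i → ancestor i a ≡ z

  Ancestor-child : ∀ {z b} → Ancestor z (parent b) → Ancestor z b
  Ancestor-child (i , eq) = suc i , eq

  Ancestor-parent : ∀ {z a} → Ancestor z a → z ≢ a → Ancestor z (parent a)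
  Ancestor-parent (zero  , eq) z≢a = ⊥-elim (z≢a (≡.sym eq))
  Ancestor-parent (suc i , eq) _   = i , eq

  Ancestor-depth-≤ : ∀ {z a} → Ancestor z a → depth z ≤ depth a
  Ancestor-depth-≤ {a = a} (i , refl) = depth-ancestor-≤ i a

  same-depth-Ancestor : ∀ {a b x} → Ancestor a x → Ancestor b x → depth a ≡ depth b → a ≡ b
  same-depth-Ancestor {x = x} (i , refl) (j , refl) a≈b with depth (ancestor i x) ℕ.≟ 0
  ... | yes a-root = trans (depth≡0⇒root a-root) (≡.sym (depth≡0⇒root (trans (≡.sym a≈b) a-root)))
  ... | no a-inner =
    cong (λ k → ancestor k x) (depth-ancestor-injective {i} {j} x (<⇒≤ (below a-inner)) (<⇒≤ (below b-inner)) a≈b)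
    where
      below : ∀ {k} → depth (ancestor k x) ≢ 0 → k < depth x
      below {k} d≢0 = m∸n≢0⇒n<m (d≢0 ∘ trans (depth-ancestor k x))
      b-inner = a-inner ∘ trans a≈b

  walk-head : ∀ {P a c} → WalkIn T P a c → P a
  walk-head (here pa)     = pa
  walk-head (step pa _ _) = pa

  walk-stays-below : ∀ {P u a c} → (∀ {t} → P t → depth u ≤ depth t) →
                     WalkIn T P a c → Ancestor u a → Ancestor u c
  walk-stays-below below (here _) u≼a = u≼a
  walk-stays-below {u = u} below (step {a} _ ab w) u≼a with adj⇒parent ab
  ... | inj₂ refl = walk-stays-below below w (Ancestor-child u≼a)
  ... | inj₁ refl with u ≟ a
  ...   | no u≢a  = walk-stays-below below w (Ancestor-parent u≼a u≢a)
  ...   | yes refl = ⊥-elim (1+n≰n (subst (_≤ depth (parent u)) (child-depth ab) (below (walk-head w))))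

  walk-exits-through : ∀ {P z a c} → WalkIn T P a c → Ancestor z a → ¬ Ancestor z c → P z
  walk-exits-through (here _) z≼a z⋠c = ⊥-elim (z⋠c z≼a)
  walk-exits-through {z = z} (step {a} pa ab w) z≼a z⋠c with z ≟ a
  ... | yes refl = pa
  ... | no z≢a with adj⇒parent ab
  ...   | inj₁ refl = walk-exits-through w (Ancestor-parent z≼a z≢a) z⋠c
  ...   | inj₂ refl = walk-exits-through w (Ancestor-child z≼a) z⋠c

∣p∪⁅x⁆∣≤1+∣p∣ : ∀ {n} (p : Subset n) x → ∣ p ∪ ⁅ x ⁆ ∣ ≤ suc ∣ p ∣
∣p∪⁅x⁆∣≤1+∣p∣ {suc n} (true  ∷ p) zero    = s≤s (≤-trans (≤-reflexive (cong (∣_∣ {n}) (∪-identityʳ p))) (n≤1+n _))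
∣p∪⁅x⁆∣≤1+∣p∣ {suc n} (false ∷ p) zero    = s≤s (≤-reflexive (cong (∣_∣ {n}) (∪-identityʳ p)))
∣p∪⁅x⁆∣≤1+∣p∣         (true  ∷ p) (suc x) = s≤s (∣p∪⁅x⁆∣≤1+∣p∣ p x)
∣p∪⁅x⁆∣≤1+∣p∣         (false ∷ p) (suc x) = ∣p∪⁅x⁆∣≤1+∣p∣ p x

∣p∣<∣p∪⁅x⁆∣ : ∀ {n} {p : Subset n} {x} → x ∉ p → ∣ p ∣ < ∣ p ∪ ⁅ x ⁆ ∣
∣p∣<∣p∪⁅x⁆∣ {x = x} x∉p = p⊂q⇒∣p∣<∣q∣ (p⊆p∪q ⁅ x ⁆ , x , x∈p∪q⁺ (inj₂ (x∈⁅x⁆ x)) , x∉p)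

p∩∁q⊂p : ∀ {n} {p q : Subset n} {x} → x ∈ p → x ∈ q → p ∩ ∁ q ⊂ p
p∩∁q⊂p {p = p} {q} x∈p x∈q = p∩q⊆p p (∁ q) , _ , x∈p , λ x∈p∩∁q → x∈∁p⇒x∉p (proj₂ (x∈p∩q⁻ p (∁ q) x∈p∩∁q)) x∈q

module _ {n : ℕ} (G : Graph n) where

  singleton-independent : ∀ {W v} → v ∈ W → IndependentIn G W ⁅ v ⁆
  singleton-independent {W} {v} v∈W = ⁅v⁆⊆W , no-loop
    where
      ⁅v⁆⊆W : ⁅ v ⁆ ⊆ W
      ⁅v⁆⊆W x∈ with x∈⁅y⁆⇒x≡y v x∈
      ... | refl = v∈W
      no-loop : ∀ {x y} → x ∈ ⁅ v ⁆ → y ∈ ⁅ v ⁆ → ¬ Adj G x y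
      no-loop x∈ y∈ with x∈⁅y⁆⇒x≡y v x∈ | x∈⁅y⁆⇒x≡y v y∈
      ... | refl | refl = irrefl G

  independent-⊆ : ∀ {W W′ I} → W ⊆ W′ → IndependentIn G W I → IndependentIn G W′ I
  independent-⊆ W⊆W′ (I⊆W , indep) = W⊆W′ ∘ I⊆W , indep

  independent-∪⁅⁆ : ∀ {W I w} → IndependentIn G W I → w ∈ W → (∀ {x} → x ∈ I → ¬ Adj G x w) →
                    IndependentIn G W (I ∪ ⁅ w ⁆)
  independent-∪⁅⁆ {W} {I} {w} (I⊆W , indep) w∈W isolated = I∪w⊆W , indep′
    where
      I∪w⊆W : I ∪ ⁅ w ⁆ ⊆ W
      I∪w⊆W x∈ with x∈p∪q⁻ I ⁅ w ⁆ x∈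
      ... | inj₁ x∈I = I⊆W x∈I
      ... | inj₂ x∈w with x∈⁅y⁆⇒x≡y w x∈w
      ...   | refl = w∈W
      indep′ : ∀ {x y} → x ∈ I ∪ ⁅ w ⁆ → y ∈ I ∪ ⁅ w ⁆ → ¬ Adj G x y
      indep′ x∈ y∈ with x∈p∪q⁻ I ⁅ w ⁆ x∈ | x∈p∪q⁻ I ⁅ w ⁆ y∈
      ... | inj₁ x∈I | inj₁ y∈I = indep x∈I y∈I
      ... | inj₁ x∈I | inj₂ y∈w with x∈⁅y⁆⇒x≡y w y∈w
      ...   | refl = isolated x∈I
      indep′ x∈ y∈ | inj₂ x∈w | inj₁ y∈I with x∈⁅y⁆⇒x≡y w x∈w
      ...   | refl = isolated y∈I ∘ sym G
      indep′ x∈ y∈ | inj₂ x∈w | inj₂ y∈w with x∈⁅y⁆⇒x≡y w x∈w | x∈⁅y⁆⇒x≡y w y∈w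
      ...   | refl | refl = irrefl G

module _ {n m : ℕ} {G : Graph n} (𝒯 : TreeDecomposition G m) where
  open Rooted (T 𝒯) (isTree 𝒯)

  covered-∪⁅⁆ : ∀ {W B t} → CoveredBy 𝒯 (W ∩ ∁ (bag 𝒯 t)) B → CoveredBy 𝒯 W (B ∪ ⁅ t ⁆)
  covered-∪⁅⁆ {W} {B} {t} cover {v} v∈W with v ∈? bag 𝒯 t
  ... | yes v∈t = t , x∈p∪q⁺ (inj₂ (x∈⁅x⁆ t)) , v∈t
  ... | no v∉t with cover (x∈p∩q⁺ (v∈W , x∉p⇒x∈∁p v∉t))
  ...   | s , s∈B , v∈s = s , x∈p∪q⁺ (inj₁ s∈B) , v∈s

  highest-bag : ∀ w → ∃ λ t → w ∈ bag 𝒯 t × (∀ {u} → w ∈ bag 𝒯 u → depth t ≤ depth u)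
  highest-bag w = optimum ≤-trans ≤-total (λ t → w ∈? bag 𝒯 t) depth (vertexCov 𝒯 w)

  top : Fin n → Fin m
  top w = proj₁ (highest-bag w)

  ∈-bag-top : ∀ w → w ∈ bag 𝒯 (top w)
  ∈-bag-top w = proj₁ (proj₂ (highest-bag w))

  top-highest : ∀ {w u} → w ∈ bag 𝒯 u → depth (top w) ≤ depth u
  top-highest {w} = proj₂ (proj₂ (highest-bag w))

  top-Ancestor : ∀ {w x} → w ∈ bag 𝒯 x → Ancestor (top w) x
  top-Ancestor {w} {x} w∈x = walk-stays-below top-highest (subtree 𝒯 w (top w) x (∈-bag-top w) w∈x) (0 , refl)

  shared-bag⇒∈-bag-top : ∀ {w v x} → w ∈ bag 𝒯 x → v ∈ bag 𝒯 x → depth (top v) ≤ depth (top w) →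
                         v ∈ bag 𝒯 (top w)
  shared-bag⇒∈-bag-top {w} {v} {x} w∈x v∈x v≤w with v ∈? bag 𝒯 (top w)
  ... | yes v∈top = v∈top
  ... | no v∉top  = ⊥-elim (v∉top (walk-exits-through v-walk (top-Ancestor w∈x) top-w⋠top-v))
    where
      v-walk = subtree 𝒯 v x (top v) v∈x (∈-bag-top v)
      top-w⋠top-v : ¬ Ancestor (top w) (top v)
      top-w⋠top-v anc = v∉top (subst (λ t → v ∈ bag 𝒯 t) tops-equal (∈-bag-top v))
        where
          tops-equal = same-depth-Ancestor (top-Ancestor v∈x) (top-Ancestor w∈x)
                                           (≤-antisym v≤w (Ancestor-depth-≤ anc))

  IndependentCover : Subset n → Set
  IndependentCover W = ∃₂ λ B I → CoveredBy 𝒯 W B × IndependentIn G W I × ∣ B ∣ ≤ ∣ I ∣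

  IndependentCover-∪⁅top⁆ : ∀ {W w} → w ∈ W → (∀ {v} → v ∈ W → depth (top v) ≤ depth (top w)) →
                            IndependentCover (W ∩ ∁ (bag 𝒯 (top w))) → IndependentCover W
  IndependentCover-∪⁅top⁆ {W} {w} w∈W deepest (B , I , cover , I-indep@(I⊆ , _) , B≤I) =
    B ∪ ⁅ top w ⁆ , I ∪ ⁅ w ⁆ , covered-∪⁅⁆ cover ,
    independent-∪⁅⁆ G (independent-⊆ G (p∩q⊆p W _) I-indep) w∈W isolated ,
    ≤-trans (∣p∪⁅x⁆∣≤1+∣p∣ B (top w)) (≤-trans (s≤s B≤I) (∣p∣<∣p∪⁅x⁆∣ w∉I))
    where
      isolated : ∀ {x} → x ∈ I → ¬ Adj G x w
      isolated x∈I xw with x∈p∩q⁻ W _ (I⊆ x∈I) | edgeCov 𝒯 _ _ xw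
      ... | x∈W , x∉top | t , x∈t , w∈t = x∈∁p⇒x∉p x∉top (shared-bag⇒∈-bag-top w∈t x∈t (deepest x∈W))
      w∉I : w ∉ I
      w∉I w∈I = x∈∁p⇒x∉p (proj₂ (x∈p∩q⁻ W _ (I⊆ w∈I))) (∈-bag-top w)

  independent-cover : ∀ W → IndependentCover W
  independent-cover = All.wfRec ⊂-wellFounded _ IndependentCover cover
    where
      cover : ∀ W → (∀ {W′} → W′ ⊂ W → IndependentCover W′) → IndependentCover W
      cover W rec with nonempty? W
      ... | no empty = ⊥ , ⊥ , (λ v∈W → ⊥-elim (empty (_ , v∈W))) , (⊥-elim ∘ ∉⊥ , ⊥-elim ∘ ∉⊥) ,
                       ≤-reflexive (trans (∣⊥∣≡0 m) (≡.sym (∣⊥∣≡0 n)))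
      ... | yes some with optimum (λ p q → ≤-trans q p) (λ a b → ≤-total b a) (_∈? W) (depth ∘ top) some
      ...   | w , w∈W , deepest = IndependentCover-∪⁅top⁆ w∈W deepest (rec (p∩∁q⊂p w∈W (∈-bag-top w)))

n≤2*n∸1 : ∀ {n} → 1 ≤ n → n ≤ 2 * n ∸ 1
n≤2*n∸1 {suc n} _ = ≤-trans (s≤s (m≤m+n n 0)) (m≤n+m (suc (n + 0)) n)

lemma9 : ∀ {n m : ℕ} (G : Graph n) (𝒯 : TreeDecomposition G m) (W : Subset n) → Nonempty W → (k : ℕ) → IndependenceNumber G W k → ∃ λ (B : Subset m) → ∣ B ∣ ≤ 2 * k ∸ 1 × CoveredBy 𝒯 W B
lemma9 G 𝒯 W (v , v∈W) k (_ , α-maximal) with independent-cover 𝒯 W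
... | B , I , cover , I-independent , ∣B∣≤∣I∣ =
  B , ≤-trans ∣B∣≤∣I∣ (≤-trans (α-maximal I I-independent) (n≤2*n∸1 1≤k)) , cover
  where
    1≤k : 1 ≤ k
    1≤k = subst (_≤ k) (∣⁅x⁆∣≡1 v) (α-maximal ⁅ v ⁆ (singleton-independent G v∈W))
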